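{- Let $\Gamma,\Delta$ be contexts, let $\rho:\Gamma\to\Delta$ be a renaming, let $P\in\mathrm{Proc}(\Gamma)$, let $\vec a$ be an action sequence starting at $\Gamma$, let $R\in\mathrm{Proc}(\Gamma+|\vec a|)$, and suppose there is a trace $P\xrightarrow{\vec a}R$. Then $\rho\vec a$ is an action sequence starting at $\Delta$ and there is a trace $\rho P\xrightarrow{\rho\vec a}(\rho+|\vec a|)R$.
   Context: Synchronous $\pi$-calculus with de Bruijn indices. Contexts $\Gamma$ are natural numbers; a name in $\Gamma$ is a natural number $x<\Gamma$. The set $\mathrm{Proc}(\Gamma)$ of processes closed by $\Gamma$ is defined inductively: $\mathbf{0}\in\mathrm{Proc}(\Gamma)$; if $x<\Gamma$ and $P\in\mathrm{Proc}(\Gamma+1)$ then $\mathsf{in}\,x.P\in\mathrm{Proc}(\Gamma)$ (input on $x$, binding index $0$ in $P$); if $x,y<\Gamma$ and $P\in\mathrm{Proc}(\Gamma)$ then $\overline{x}\langle y\rangle.P\in\mathrm{Proc}(\Gamma)$; if $P,Q\in\mathrm{Proc}(\Gamma)$ then $P+Q$ and $P\mid Q$ are in $\mathrm{Proc}(\Gamma)$; if $P\in\mathrm{Proc}(\Gamma+1)$ then $\nu P\in\mathrm{Proc}(\Gamma)$; if $P\in\mathrm{Proc}(\Gamma)$ then $!P\in\mathrm{Proc}(\Gamma)$. Actions in $\Gamma$ are: bound actions $\mathsf{in}\,x$ (input) and $\overline{x}\langle\cdot\rangle$ (bound output) for $x<\Gamma$, and non-bound actions $\overline{x}\langle y\rangle$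 (output) for $x,y<\Gamma$ and $\tau$. Set $|a|=1$ if $a$ is bound and $|a|=0$ otherwise. A renaming $\rho:\Gamma\to\Delta$ is any function $\{0,\dots,\Gamma-1\}\to\{0,\dots,\Delta-1\}$. Its lifting $\rho+1:\Gamma+1\to\Delta+1$ maps $0\mapsto0$ and $x+1\mapsto\rho(x)+1$; $\rho+n$ is the $n$-fold lifting. Renamings act on actions by renaming every name ($\rho\tau=\tau$), and on processes by: $\rho\mathbf{0}=\mathbf{0}$, $\rho(\mathsf{in}\,x.P)=\mathsf{in}\,\rho(x).((\rho+1)P)$, $\rho(\overline{x}\langle y\rangle.P)=\overline{\rho x}\langle\rho y\rangle.\rho P$, $\rho(P+Q)=\rho P+\rho Q$, $\rho(P\mid Q)=\rho P\mid\rho Q$, $\rho(\nu P)=\nu((\rho+1)P)$, $\rho(!P)=!\rho P$. Special renamings: $\mathsf{push}:\Gamma\to\Gamma+1$, $x\mapsto x+1$; for $y<\Gamma$, $\mathsf{pop}\,y:\Gamma+1\to\Gamma$, $0\mapsto y$, $x+1\mapsto x$; $\mathsf{swap}:\Gamma+2\to\Gamma+2$ exchanging $0$ and $1$ and fixing all $x\ge2$. Transitions: for $P\in\mathrm{Proc}(\Gamma)$, an action $a$ in $\Gamma$ and $R\in\mathrm{Proc}(\Gamma+|a|)$, the relation $P\xrightarrow{a}R$ is the least relation closed under the following rules ($b$ ranges over bound actions, $c$ over non-bound actions): $\mathsf{in}\,x.P\xrightarrow{\mathsf{in}\,x}P$; $\overline{x}\langle y\rangle.P\xrightarrow{\overline{x}\langle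 y\rangle}P$; if $P\xrightarrow{a}R$ then $P+Q\xrightarrow{a}R$; if $Q\xrightarrow{a}S$ then $P+Q\xrightarrow{a}S$; if $P\xrightarrow{c}R$ then $P\mid Q\xrightarrow{c}R\mid Q$; if $Q\xrightarrow{c}S$ then $P\mid Q\xrightarrow{c}P\mid S$; if $P\xrightarrow{b}R$ then $P\mid Q\xrightarrow{b}R\mid\mathsf{push}\,Q$; if $Q\xrightarrow{b}S$ then $P\mid Q\xrightarrow{b}\mathsf{push}\,P\mid S$; if $P\xrightarrow{\mathsf{in}\,x}R$ and $Q\xrightarrow{\overline{x}\langle y\rangle}S$ then $P\mid Q\xrightarrow{\tau}(\mathsf{pop}\,y)R\mid S$; symmetrically if $P\xrightarrow{\overline{x}\langle y\rangle}R$ and $Q\xrightarrow{\mathsf{in}\,x}S$ then $P\mid Q\xrightarrow{\tau}R\mid(\mathsf{pop}\,y)S$; if $P\xrightarrow{\overline{x+1}\langle 0\rangle}R$ then $\nu P\xrightarrow{\overline{x}\langle\cdot\rangle}R$; if $P\xrightarrow{\mathsf{in}\,x}R$ and $Q\xrightarrow{\overline{x}\langle\cdot\rangle}S$ then $P\mid Q\xrightarrow{\tau}\nu(R\mid S)$; symmetrically if $P\xrightarrow{\overline{x}\langle\cdot\rangle}R$ and $Q\xrightarrow{\mathsf{in}\,x}S$ then $P\mid Q\xrightarrow{\tau}\nu(R\mid S)$; if $P\xrightarrow{\mathsf{push}\,c}R$ then $\nu P\xrightarrow{c}\nu R$; if $P\xrightarrow{\mathsf{push}\,b}R$ then $\nu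 P\xrightarrow{b}\nu(\mathsf{swap}\,R)$; if $P\mid !P\xrightarrow{a}R$ then $!P\xrightarrow{a}R$. Action sequences and traces: an action sequence starting at $\Gamma$ is either the empty sequence $\varepsilon_\Gamma$ or $a\cdot\vec a$ where $a$ is an action in $\Gamma$ and $\vec a$ is an action sequence starting at $\Gamma+|a|$; $|\vec a|$ is the sum of $|a|$ over the actions of $\vec a$. A trace $P\xrightarrow{\vec a}R$ is a finite sequence of composable transitions: $P\xrightarrow{\varepsilon_\Gamma}P$, and if $P\xrightarrow{a}R'$ and $R'\xrightarrow{\vec a}R$ then $P\xrightarrow{a\cdot\vec a}R$. Renaming of action sequences: for $\rho:\Gamma\to\Delta$, $\rho\,\varepsilon_\Gamma=\varepsilon_\Delta$ and $\rho(a\cdot\vec a)=(\rho a)\cdot((\rho+|a|)\vec a)$. -}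

module Defs where

open import Data.Nat using (ℕ; zero; suc; _+_)
open import Data.Fin using (Fin; zero; suc)

-- Names in context Γ are elements of Fin Γ (de Bruijn indices x < Γ).

infixr 5 _⊕_
infixr 6 _∥_
infix 7 !_

data Proc (Γ : ℕ) : Set where
  𝟘    : Proc Γ
  inp  : Fin Γ → Proc (suc Γ) → Proc Γ
  out  : Fin Γ → Fin Γ → Proc Γ → Proc Γ
  _⊕_  : Proc Γ → Proc Γ → Proc Γ
  _∥_  : Proc Γ → Proc Γ → Proc Γ
  ν    : Proc (suc Γ) → Proc Γ
  !_   : Proc Γ → Proc Γ

data Action (Γ : ℕ) : Set where
  ain  : Fin Γ → Action Γ
  abo  : Fin Γ → Action Γ              -- x̄⟨·⟩       (bound output)
  aout : Fin Γ → Fin Γ → Action Γ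
  τ    : Action Γ

∣_∣ : ∀ {Γ} → Action Γ → ℕ
∣ ain x ∣    = 1
∣ abo x ∣    = 1
∣ aout x y ∣ = 0
∣ τ ∣        = 0

-- Γ + |a|, computed so that it reduces to suc Γ / Γ for bound / non-bound actions
_⊹_ : (Γ : ℕ) → Action Γ → ℕ
Γ ⊹ ain x    = suc Γ
Γ ⊹ abo x    = suc Γ
Γ ⊹ aout x y = Γ
Γ ⊹ τ        = Γ

Ren : ℕ → ℕ → Set
Ren Γ Δ = Fin Γ → Fin Δ

lift : ∀ {Γ Δ} → Ren Γ Δ → Ren (suc Γ) (suc Δ)
lift ρ zero    = zero
lift ρ (suc x) = suc (ρ x)

liftN : ∀ {Γ Δ} (n : ℕ) → Ren Γ Δ → Ren (n + Γ) (n + Δ)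
liftN zero    ρ = ρ
liftN (suc n) ρ = lift (liftN n ρ)

push : ∀ {Γ} → Ren Γ (suc Γ)
push = suc

pop : ∀ {Γ} → Fin Γ → Ren (suc Γ) Γ
pop y zero    = y
pop y (suc x) = x

swap : ∀ {Γ} → Ren (suc (suc Γ)) (suc (suc Γ))
swap zero          = suc zero
swap (suc zero)    = zero
swap (suc (suc x)) = suc (suc x)

renP : ∀ {Γ Δ} → Ren Γ Δ → Proc Γ → Proc Δ
renP ρ 𝟘         = 𝟘
renP ρ (inp x P) = inp (ρ x) (renP (lift ρ) P)
renP ρ (out x y P) = out (ρ x) (ρ y) (renP ρ P)
renP ρ (P ⊕ Q)   = renP ρ P ⊕ renP ρ Q
renP ρ (P ∥ Q)   = renP ρ P ∥ renP ρ Q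
renP ρ (ν P)     = ν (renP (lift ρ) P)
renP ρ (! P)     = ! renP ρ P

renA : ∀ {Γ Δ} → Ren Γ Δ → Action Γ → Action Δ
renA ρ (ain x)    = ain (ρ x)
renA ρ (abo x)    = abo (ρ x)
renA ρ (aout x y) = aout (ρ x) (ρ y)
renA ρ τ          = τ

liftA : ∀ {Γ Δ} (ρ : Ren Γ Δ) (a : Action Γ) → Ren (Γ ⊹ a) (Δ ⊹ renA ρ a)
liftA ρ (ain x)    = lift ρ
liftA ρ (abo x)    = lift ρ
liftA ρ (aout x y) = ρ
liftA ρ τ          = ρ

infix 4 _—[_]→_
data _—[_]→_ {Γ : ℕ} : (P : Proc Γ) (a : Action Γ) → Proc (Γ ⊹ a) → Set where
  t-in   : ∀ {x P} → inp x P —[ ain x ]→ P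
  t-out  : ∀ {x y P} → out x y P —[ aout x y ]→ P
  t-sumL : ∀ {P Q a R} → P —[ a ]→ R → (P ⊕ Q) —[ a ]→ R
  t-sumR : ∀ {P Q a S} → Q —[ a ]→ S → (P ⊕ Q) —[ a ]→ S
  t-parL-out : ∀ {P Q x y R} → P —[ aout x y ]→ R → (P ∥ Q) —[ aout x y ]→ (R ∥ Q)
  t-parL-τ   : ∀ {P Q R} → P —[ τ ]→ R → (P ∥ Q) —[ τ ]→ (R ∥ Q)
  t-parR-out : ∀ {P Q x y S} → Q —[ aout x y ]→ S → (P ∥ Q) —[ aout x y ]→ (P ∥ S)
  t-parR-τ   : ∀ {P Q S} → Q —[ τ ]→ S → (P ∥ Q) —[ τ ]→ (P ∥ S)
  t-parL-in  : ∀ {P Q x R} → P —[ ain x ]→ R → (P ∥ Q) —[ ain x ]→ (R ∥ renP push Q)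
  t-parL-bo  : ∀ {P Q x R} → P —[ abo x ]→ R → (P ∥ Q) —[ abo x ]→ (R ∥ renP push Q)
  t-parR-in  : ∀ {P Q x S} → Q —[ ain x ]→ S → (P ∥ Q) —[ ain x ]→ (renP push P ∥ S)
  t-parR-bo  : ∀ {P Q x S} → Q —[ abo x ]→ S → (P ∥ Q) —[ abo x ]→ (renP push P ∥ S)
  t-comL : ∀ {P Q x y R S} → P —[ ain x ]→ R → Q —[ aout x y ]→ S
         → (P ∥ Q) —[ τ ]→ (renP (pop y) R ∥ S)
  t-comR : ∀ {P Q x y R S} → P —[ aout x y ]→ R → Q —[ ain x ]→ S
         → (P ∥ Q) —[ τ ]→ (R ∥ renP (pop y) S)
  t-open : ∀ {P x R} → P —[ aout (suc x) zero ]→ R → ν P —[ abo x ]→ R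
  t-closeL : ∀ {P Q x R S} → P —[ ain x ]→ R → Q —[ abo x ]→ S
           → (P ∥ Q) —[ τ ]→ ν (R ∥ S)
  t-closeR : ∀ {P Q x R S} → P —[ abo x ]→ R → Q —[ ain x ]→ S
           → (P ∥ Q) —[ τ ]→ ν (R ∥ S)
  t-res-out : ∀ {P x y R} → P —[ aout (push x) (push y) ]→ R → ν P —[ aout x y ]→ ν R
  t-res-τ   : ∀ {P R} → P —[ τ ]→ R → ν P —[ τ ]→ ν R
  t-res-in  : ∀ {P x R} → P —[ ain (push x) ]→ R → ν P —[ ain x ]→ ν (renP swap R)
  t-res-bo  : ∀ {P x R} → P —[ abo (push x) ]→ R → ν P —[ abo x ]→ ν (renP swap R)
  t-rep : ∀ {P a R} → (P ∥ ! P) —[ a ]→ R → ! P —[ a ]→ R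

data ActSeq (Γ : ℕ) : Set where
  ε   : ActSeq Γ
  _·_ : (a : Action Γ) → ActSeq (Γ ⊹ a) → ActSeq Γ

∣_∣ₛ : ∀ {Γ} → ActSeq Γ → ℕ
∣ ε ∣ₛ     = 0
∣ a · as ∣ₛ = ∣ a ∣ + ∣ as ∣ₛ

_⊹ₛ_ : (Γ : ℕ) → ActSeq Γ → ℕ
Γ ⊹ₛ ε        = Γ
Γ ⊹ₛ (a · as) = (Γ ⊹ a) ⊹ₛ as

renS : ∀ {Γ Δ} → Ren Γ Δ → ActSeq Γ → ActSeq Δ
renS ρ ε        = ε
renS ρ (a · as) = renA ρ a · renS (liftA ρ a) as

liftS : ∀ {Γ Δ} (ρ : Ren Γ Δ) (as : ActSeq Γ) → Ren (Γ ⊹ₛ as) (Δ ⊹ₛ renS ρ as)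
liftS ρ ε        = ρ
liftS ρ (a · as) = liftS (liftA ρ a) as

infix 4 _—[_]↠_
data _—[_]↠_ {Γ : ℕ} : (P : Proc Γ) (as : ActSeq Γ) → Proc (Γ ⊹ₛ as) → Set where
  tr-ε   : ∀ {P} → P —[ ε ]↠ P
  tr-∷   : ∀ {P a R′ as R} → P —[ a ]→ R′ → R′ —[ as ]↠ R → P —[ a · as ]↠ R

-- Renaming commutes with every transition rule, so P —[ a ]→ R is mapped rule by
-- rule to ρ P —[ ρ a ]→ (ρ + |a|) R.  The only rules needing an argument are those
-- whose target is itself renamed, and they go through because of the renaming
-- identities (ρ+1) ∘ push = push ∘ ρ,  ρ ∘ pop y = pop (ρ y) ∘ (ρ+1)  and
-- (ρ+2) ∘ swap = swap ∘ (ρ+2).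
module Submission where

open import Defs
open import Data.Nat using (ℕ)
open import Data.Fin using (zero; suc)
open import Function.Base using (_∘_)
open import Relation.Binary.PropositionalEquality
  using (_≡_; refl; sym; trans; cong; cong₂; subst; _≗_)

lift-cong : ∀ {Γ Δ} {f g : Ren Γ Δ} → f ≗ g → lift f ≗ lift g
lift-cong f≗g zero    = refl
lift-cong f≗g (suc x) = cong suc (f≗g x)

renP-cong : ∀ {Γ Δ} {f g : Ren Γ Δ} → f ≗ g → renP f ≗ renP g
renP-cong f≗g 𝟘           = refl
renP-cong f≗g (inp x P)   = cong₂ inp (f≗g x) (renP-cong (lift-cong f≗g) P)
renP-cong f≗g (out x y P) = trans (cong₂ (λ x′ y′ → out x′ y′ _) (f≗g x) (f≗g y))
                                  (cong (out _ _) (renP-cong f≗g P))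
renP-cong f≗g (P ⊕ Q)     = cong₂ _⊕_ (renP-cong f≗g P) (renP-cong f≗g Q)
renP-cong f≗g (P ∥ Q)     = cong₂ _∥_ (renP-cong f≗g P) (renP-cong f≗g Q)
renP-cong f≗g (ν P)       = cong ν (renP-cong (lift-cong f≗g) P)
renP-cong f≗g (! P)       = cong !_ (renP-cong f≗g P)

lift-∘ : ∀ {Γ Δ Θ} (f : Ren Δ Θ) (g : Ren Γ Δ) → lift f ∘ lift g ≗ lift (f ∘ g)
lift-∘ f g zero    = refl
lift-∘ f g (suc x) = refl

renP-∘ : ∀ {Γ Δ Θ} (f : Ren Δ Θ) (g : Ren Γ Δ) → renP f ∘ renP g ≗ renP (f ∘ g)
renP-∘ f g 𝟘           = refl
renP-∘ f g (inp x P)   = cong (inp _) (trans (renP-∘ (lift f) (lift g) P) (renP-cong (lift-∘ f g) P))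
renP-∘ f g (out x y P) = cong (out _ _) (renP-∘ f g P)
renP-∘ f g (P ⊕ Q)     = cong₂ _⊕_ (renP-∘ f g P) (renP-∘ f g Q)
renP-∘ f g (P ∥ Q)     = cong₂ _∥_ (renP-∘ f g P) (renP-∘ f g Q)
renP-∘ f g (ν P)       = cong ν (trans (renP-∘ (lift f) (lift g) P) (renP-cong (lift-∘ f g) P))
renP-∘ f g (! P)       = cong !_ (renP-∘ f g P)

renP-square : ∀ {Γ Γ′ Δ Δ′} (f : Ren Δ Δ′) (g : Ren Γ Δ) (h : Ren Γ′ Δ′) (k : Ren Γ Γ′)
            → f ∘ g ≗ h ∘ k → renP f ∘ renP g ≗ renP h ∘ renP k
renP-square f g h k square P =
  trans (renP-∘ f g P) (trans (renP-cong square P) (sym (renP-∘ h k P)))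

renP-lift-push : ∀ {Γ Δ} (ρ : Ren Γ Δ) → renP (lift ρ) ∘ renP push ≗ renP push ∘ renP ρ
renP-lift-push ρ = renP-square (lift ρ) push push ρ (λ x → refl)

renP-pop : ∀ {Γ Δ} (ρ : Ren Γ Δ) y → renP ρ ∘ renP (pop y) ≗ renP (pop (ρ y)) ∘ renP (lift ρ)
renP-pop ρ y = renP-square ρ (pop y) (pop (ρ y)) (lift ρ) λ { zero → refl ; (suc x) → refl }

renP-lift²-swap : ∀ {Γ Δ} (ρ : Ren Γ Δ)
                → renP (lift (lift ρ)) ∘ renP swap ≗ renP swap ∘ renP (lift (lift ρ))
renP-lift²-swap ρ = renP-square (lift (lift ρ)) swap swap (lift (lift ρ))
  λ { zero → refl ; (suc zero) → refl ; (suc (suc x)) → refl }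

retarget : ∀ {Γ} {P : Proc Γ} {a R R′} → R ≡ R′ → P —[ a ]→ R → P —[ a ]→ R′
retarget {P = P} {a} = subst (P —[ a ]→_)

—→-ren : ∀ {Γ Δ} (ρ : Ren Γ Δ) {P : Proc Γ} {a R}
       → P —[ a ]→ R → renP ρ P —[ renA ρ a ]→ renP (liftA ρ a) R
—→-ren ρ t-in                  = t-in
—→-ren ρ t-out                 = t-out
—→-ren ρ (t-sumL t)            = t-sumL (—→-ren ρ t)
—→-ren ρ (t-sumR t)            = t-sumR (—→-ren ρ t)
—→-ren ρ (t-parL-out t)        = t-parL-out (—→-ren ρ t)
—→-ren ρ (t-parL-τ t)          = t-parL-τ (—→-ren ρ t)
—→-ren ρ (t-parR-out t)        = t-parR-out (—→-ren ρ t)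
—→-ren ρ (t-parR-τ t)          = t-parR-τ (—→-ren ρ t)
—→-ren ρ (t-parL-in {Q = Q} t) =
  retarget (cong (_ ∥_) (sym (renP-lift-push ρ Q))) (t-parL-in (—→-ren ρ t))
—→-ren ρ (t-parL-bo {Q = Q} t) =
  retarget (cong (_ ∥_) (sym (renP-lift-push ρ Q))) (t-parL-bo (—→-ren ρ t))
—→-ren ρ (t-parR-in {P = P} t) =
  retarget (cong (_∥ _) (sym (renP-lift-push ρ P))) (t-parR-in (—→-ren ρ t))
—→-ren ρ (t-parR-bo {P = P} t) =
  retarget (cong (_∥ _) (sym (renP-lift-push ρ P))) (t-parR-bo (—→-ren ρ t))
—→-ren ρ (t-comL {y = y} {R = R} t u) =
  retarget (cong (_∥ _) (sym (renP-pop ρ y R))) (t-comL (—→-ren ρ t) (—→-ren ρ u))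
—→-ren ρ (t-comR {y = y} {S = S} t u) =
  retarget (cong (_ ∥_) (sym (renP-pop ρ y S))) (t-comR (—→-ren ρ t) (—→-ren ρ u))
—→-ren ρ (t-open t)            = t-open (—→-ren (lift ρ) t)
—→-ren ρ (t-closeL t u)        = t-closeL (—→-ren ρ t) (—→-ren ρ u)
—→-ren ρ (t-closeR t u)        = t-closeR (—→-ren ρ t) (—→-ren ρ u)
—→-ren ρ (t-res-out t)         = t-res-out (—→-ren (lift ρ) t)
—→-ren ρ (t-res-τ t)           = t-res-τ (—→-ren (lift ρ) t)
—→-ren ρ (t-res-in {R = R} t)  =
  retarget (cong ν (sym (renP-lift²-swap ρ R))) (t-res-in (—→-ren (lift ρ) t))
—→-ren ρ (t-res-bo {R = R} t)  =
  retarget (cong ν (sym (renP-lift²-swap ρ R))) (t-res-bo (—→-ren (lift ρ) t))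
—→-ren ρ (t-rep t)             = t-rep (—→-ren ρ t)

lemma4p1 : {Γ Δ : ℕ} (ρ : Ren Γ Δ) (P : Proc Γ) (as : ActSeq Γ) (R : Proc (Γ ⊹ₛ as))
         → P —[ as ]↠ R
         → renP ρ P —[ renS ρ as ]↠ renP (liftS ρ as) R
lemma4p1 ρ P ε        .P tr-ε                    = tr-ε
lemma4p1 ρ P (a · as) R (tr-∷ {R′ = R′} t trace) =
  tr-∷ (—→-ren ρ t) (lemma4p1 (liftA ρ a) R′ as R trace)
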